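{- Let $L\subseteq\mathbb{C}^n$ be a linear subspace. The ideal $I_L^{\mathrm{SE}}$ is contained in the kernel of $\varphi_L$.
   Context: Let $M$ be the matroid of $L$ on $[n]$ (circuits are the minimal nonempty supports of linear forms vanishing on $L$). For each circuit $C$ fix coefficients $\alpha_{C,i}$ ($i\in C$) of a nonzero linear form $\sum_{i\in C}\alpha_{C,i}x_i$ vanishing on $L$ (unique up to scaling). Let $\widetilde I_L\subseteq\mathbb{C}[x_1,y_1,\dots,x_n,y_n]$ be generated by $\widetilde f_C=\sum_{i\in C}\alpha_{C,i}x_i\prod_{j\in C\setminus i}y_j$ over all circuits $C$, and $\varphi_L:\mathbb{C}[z_S:S\subseteq[n]]\to\mathbb{C}[x_1,y_1,\dots,x_n,y_n]/\widetilde I_L$, $z_S\mapsto\prod_{i\in S}x_i\prod_{i\notin S}y_i$. For a circuit $C$ and $A\subseteq[n]\setminus C$, $f_C^A(z)=\sum_{i\in C}\alpha_{C,i}z_{A\cup\{i\}}$; $I_L^{\mathrm{SE}}$ is the ideal generated by all $z_Sz_T-z_{S\cup T}z_{S\cap T}$ ($S,T\subseteq[n]$) and all $f_C^A(z)$. -}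

module Defs where

open import Level using (Level; _⊔_) renaming (suc to lsuc)
open import Algebra.Bundles using (CommutativeRing)
open import Data.Nat using (ℕ; zero; suc)
open import Data.Fin using (Fin; zero; suc; _≟_)
open import Data.Fin.Subset using (Subset; _∈_; _∉_; _⊂_; _∪_; _∩_; ⁅_⁆; Nonempty)
open import Data.Vec using (lookup)
open import Data.Bool using (Bool; true; false; if_then_else_)
open import Data.Sum using (_⊎_; inj₁; inj₂)
open import Data.Product using (Σ; Σ-syntax; ∃; _×_; _,_)
open import Relation.Nullary using (¬_; does)
open import Relation.Binary.PropositionalEquality using (_≡_)

record Field (c ℓ : Level) : Set (lsuc (c ⊔ ℓ)) where
  field
    commutativeRing : CommutativeRing c ℓ
  open CommutativeRing commutativeRing public
  field
    1≉0     : ¬ (1# ≈ 0#)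
    inverse : ∀ x → ¬ (x ≈ 0#) → ∃ λ y → (x * y) ≈ 1#

-- Polynomial rings R[V] over a commutative ring R in a set of variables V,
-- presented as the free commutative R-algebra on V: syntactic expressions
-- modulo the congruence generated by the commutative-semiring laws and the
-- laws making  con : R → R[V]  a ring homomorphism (negation is con(-1) * _).

module Poly {c ℓ : Level} (R : CommutativeRing c ℓ) where
  open CommutativeRing R using (Carrier; _≈_; _+_; _*_; 0#; 1#)

  infixl 6 _⊕_
  infixl 7 _⊗_

  data Expr {v : Level} (V : Set v) : Set (c ⊔ v) where
    con : Carrier → Expr V
    var : V → Expr V
    _⊕_ : Expr V → Expr V → Expr V
    _⊗_ : Expr V → Expr V → Expr V

  module _ {v : Level} {V : Set v} where

    infix 4 _≃_

    data _≃_ : Expr V → Expr V → Set (c ⊔ ℓ ⊔ v) where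
      ≃-refl  : ∀ {p} → p ≃ p
      ≃-sym   : ∀ {p q} → p ≃ q → q ≃ p
      ≃-trans : ∀ {p q r} → p ≃ q → q ≃ r → p ≃ r
      ⊕-cong : ∀ {p p' q q'} → p ≃ p' → q ≃ q' → p ⊕ q ≃ p' ⊕ q'
      ⊗-cong : ∀ {p p' q q'} → p ≃ p' → q ≃ q' → p ⊗ q ≃ p' ⊗ q'
      ⊕-assoc  : ∀ p q r → (p ⊕ q) ⊕ r ≃ p ⊕ (q ⊕ r)
      ⊕-comm   : ∀ p q → p ⊕ q ≃ q ⊕ p
      ⊕-identˡ : ∀ p → con 0# ⊕ p ≃ p
      ⊗-assoc  : ∀ p q r → (p ⊗ q) ⊗ r ≃ p ⊗ (q ⊗ r)
      ⊗-comm   : ∀ p q → p ⊗ q ≃ q ⊗ p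
      ⊗-identˡ : ∀ p → con 1# ⊗ p ≃ p
      ⊗-zeroˡ  : ∀ p → con 0# ⊗ p ≃ con 0#
      distribˡ : ∀ p q r → p ⊗ (q ⊕ r) ≃ (p ⊗ q) ⊕ (p ⊗ r)
      con-cong : ∀ {a b} → a ≈ b → con a ≃ con b
      con-+    : ∀ a b → con (a + b) ≃ con a ⊕ con b
      con-*    : ∀ a b → con (a * b) ≃ con a ⊗ con b

    data InIdeal (G : Expr V → Set (c ⊔ ℓ ⊔ v)) : Expr V → Set (c ⊔ ℓ ⊔ v) where
      gen   : ∀ {p} → G p → InIdeal G p
      zero∈ : InIdeal G (con 0#)
      add   : ∀ {p q} → InIdeal G p → InIdeal G q → InIdeal G (p ⊕ q)
      mul   : ∀ r {p} → InIdeal G p → InIdeal G (r ⊗ p)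
      resp  : ∀ {p q} → p ≃ q → InIdeal G p → InIdeal G q

  subst : {v w : Level} {V : Set v} {W : Set w} → (V → Expr W) → Expr V → Expr W
  subst σ (con a) = con a
  subst σ (var x) = σ x
  subst σ (p ⊕ q) = subst σ p ⊕ subst σ q
  subst σ (p ⊗ q) = subst σ p ⊗ subst σ q

  ∑ : {v : Level} {V : Set v} (n : ℕ) → (Fin n → Expr V) → Expr V
  ∑ zero    f = con 0#
  ∑ (suc n) f = f zero ⊕ ∑ n (λ i → f (suc i))

  ∏ : {v : Level} {V : Set v} (n : ℕ) → (Fin n → Expr V) → Expr V
  ∏ zero    f = con 1#
  ∏ (suc n) f = f zero ⊗ ∏ n (λ i → f (suc i))

-- The setting of the paper, over a field F (in place of ℂ).

module Setting {c ℓ : Level} (F : Field c ℓ) (n : ℕ) where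
  open Field F using (commutativeRing; Carrier; _≈_; _+_; _*_; -_; 0#; 1#)
  open Poly commutativeRing public

  sumF : (m : ℕ) → (Fin m → Carrier) → Carrier
  sumF zero    f = 0#
  sumF (suc m) f = f zero + sumF m (λ i → f (suc i))

  Vector : Set c
  Vector = Fin n → Carrier

  record IsSubspace (L : Vector → Set ℓ) : Set (c ⊔ ℓ) where
    field
      resp-≈  : ∀ {u v} → (∀ i → u i ≈ v i) → L u → L v
      has-0   : L (λ _ → 0#)
      +-closed : ∀ {u v} → L u → L v → L (λ i → u i + v i)
      *-closed : ∀ a {u} → L u → L (λ i → a * u i)

  VanishesOn : (L : Vector → Set ℓ) → Vector → Set (c ⊔ ℓ)
  VanishesOn L a = ∀ u → L u → sumF n (λ i → a i * u i) ≈ 0#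

  HasSupport : Vector → Subset n → Set ℓ
  HasSupport a C = ∀ i → (i ∈ C → ¬ (a i ≈ 0#)) × (i ∉ C → a i ≈ 0#)

  IsCircuit : (L : Vector → Set ℓ) → Subset n → Set (c ⊔ ℓ)
  IsCircuit L C =
    Nonempty C
    × (Σ[ a ∈ Vector ] (HasSupport a C × VanishesOn L a))
    × (∀ D → D ⊂ C → Nonempty D → ¬ (Σ[ a ∈ Vector ] (HasSupport a D × VanishesOn L a)))

  CircuitForms : (L : Vector → Set ℓ) → Set (c ⊔ ℓ)
  CircuitForms L = (C : Subset n) → IsCircuit L C → Vector

  ValidCircuitForms : (L : Vector → Set ℓ) → CircuitForms L → Set (c ⊔ ℓ)
  ValidCircuitForms L α =
    ∀ C (cC : IsCircuit L C) → HasSupport (α C cC) C × VanishesOn L (α C cC)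

  -- variables of C[x_1,y_1,…,x_n,y_n]: inj₁ i = x_i, inj₂ i = y_i
  XY : Set
  XY = Fin n ⊎ Fin n

  x y : Fin n → Expr XY
  x i = var (inj₁ i)
  y i = var (inj₂ i)

  Z : Set
  Z = Subset n

  z : Subset n → Expr Z
  z S = var S

  ifE : {v : Level} {V : Set v} → Bool → Expr V → Expr V → Expr V
  ifE b p q = if b then p else q

  -- f̃_C = ∑_{i∈C} α_{C,i} x_i ∏_{j∈C∖i} y_j
  ftilde : Vector → Subset n → Expr XY
  ftilde α C = ∑ n (λ i → ifE (lookup C i)
     (con (α i) ⊗ x i ⊗ ∏ n (λ j → ifE (lookup C j)
                                      (ifE (does (i ≟ j)) (con 1#) (y j))
                                      (con 1#)))
     (con 0#))

  GenTilde : (L : Vector → Set ℓ) → CircuitForms L → Expr XY → Set (c ⊔ ℓ)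
  GenTilde L α p = Σ[ C ∈ Subset n ] Σ[ cC ∈ IsCircuit L C ] (p ≡ ftilde (α C cC) C)

  φvar : Subset n → Expr XY
  φvar S = ∏ n (λ i → ifE (lookup S i) (x i) (y i))

  φ : Expr Z → Expr XY
  φ = subst φvar

  fCA : Vector → Subset n → Subset n → Expr Z
  fCA α C A = ∑ n (λ i → ifE (lookup C i) (con (α i) ⊗ z (A ∪ ⁅ i ⁆)) (con 0#))

  binom : Subset n → Subset n → Expr Z
  binom S T = z S ⊗ z T ⊕ con (- 1#) ⊗ (z (S ∪ T) ⊗ z (S ∩ T))

  GenSE : (L : Vector → Set ℓ) → CircuitForms L → Expr Z → Set (c ⊔ ℓ)
  GenSE L α p =
    (Σ[ S ∈ Subset n ] Σ[ T ∈ Subset n ] (p ≡ binom S T))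
    ⊎ (Σ[ C ∈ Subset n ] Σ[ cC ∈ IsCircuit L C ] Σ[ A ∈ Subset n ]
         ((∀ i → i ∈ A → i ∉ C) × (p ≡ fCA (α C cC) C A)))

{-# OPTIONS --safe #-}
module Submission where

-- φ_L is a ring homomorphism, so it suffices to send each generator of I_L^SE
-- into Ĩ_L. At every index i, z_S z_T and z_{S∪T} z_{S∩T} receive the same pair
-- of variables (x_i x_i, x_i y_i or y_i y_i), so binomials go to 0. For A
-- disjoint from C and i ∈ C, φ_L(z_{A∪i}) = m · x_i ∏_{j∈C∖i} y_j with
-- m = ∏_{j∈A} x_j ∏_{j∉A∪C} y_j independent of i, so φ_L(f_C^A) = m · f̃_C.

open import Defs
open import Level using (Level; _⊔_)
open import Algebra.Bundles using (CommutativeRing; CommutativeSemiring)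
open import Algebra.Structures.Biased using (isCommutativeMonoidˡ; isCommutativeSemiringˡ)
import Algebra.Properties.CommutativeSemigroup as CommutativeSemigroupProperties
import Algebra.Properties.CommutativeMonoid.Sum as CommutativeMonoidSum
import Algebra.Properties.Semiring.Sum as SemiringSum
open import Data.Bool using (true; false; _∨_; _∧_; if_then_else_)
open import Data.Empty using (⊥; ⊥-elim)
open import Data.Fin using (Fin; zero; suc; _≟_)
open import Data.Fin.Subset using (Subset; _∈_; _∉_; _∪_; _∩_; ⁅_⁆)
open import Data.Nat using (ℕ; zero; suc)
open import Data.Product using (_,_)
open import Data.Sum using (inj₁; inj₂)
open import Data.Vec using (lookup)
open import Data.Vec.Properties using (lookup-replicate; lookup-zipWith; lookup⇒[]=)
open import Function using (_∘_)
open import Relation.Binary.Bundles using (Setoid)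
open import Relation.Binary.Structures using (IsEquivalence)
open import Relation.Binary.PropositionalEquality using (_≡_; refl; sym; cong; cong₂; subst₂)
open import Relation.Nullary using (does; yes; no)

lookup-⁅⁆ : ∀ {m} (i j : Fin m) → lookup ⁅ i ⁆ j ≡ does (i ≟ j)
lookup-⁅⁆ zero    zero    = refl
lookup-⁅⁆ zero    (suc j) = lookup-replicate j false
lookup-⁅⁆ (suc i) zero    = refl
lookup-⁅⁆ (suc i) (suc j) = lookup-⁅⁆ i j

module PolyProperties {c ℓ : Level} (R : CommutativeRing c ℓ) where
  open CommutativeRing R using (_+_; 0#; 1#; -_; -‿inverseʳ)
  open Poly R

  module _ {v : Level} {V : Set v} where

    ≃-isEquivalence : IsEquivalence (_≃_ {V = V})
    ≃-isEquivalence = record { refl = ≃-refl ; sym = ≃-sym ; trans = ≃-trans }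

    ≃-setoid : Setoid (c ⊔ v) (c ⊔ ℓ ⊔ v)
    ≃-setoid = record { isEquivalence = ≃-isEquivalence }

    ⊗-distribʳ : ∀ (p q r : Expr V) → (q ⊕ r) ⊗ p ≃ q ⊗ p ⊕ r ⊗ p
    ⊗-distribʳ p q r =
      ≃-trans (⊗-comm _ _) (≃-trans (distribˡ p q r) (⊕-cong (⊗-comm p q) (⊗-comm p r)))

    commutativeSemiring : CommutativeSemiring (c ⊔ v) (c ⊔ ℓ ⊔ v)
    commutativeSemiring = record
      { isCommutativeSemiring = isCommutativeSemiringˡ record
        { +-isCommutativeMonoid = isCommutativeMonoidˡ record
          { isSemigroup = record
            { isMagma = record { isEquivalence = ≃-isEquivalence ; ∙-cong = ⊕-cong }
            ; assoc = ⊕-assoc }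
          ; identityˡ = ⊕-identˡ
          ; comm = ⊕-comm }
        ; *-isCommutativeMonoid = isCommutativeMonoidˡ record
          { isSemigroup = record
            { isMagma = record { isEquivalence = ≃-isEquivalence ; ∙-cong = ⊗-cong }
            ; assoc = ⊗-assoc }
          ; identityˡ = ⊗-identˡ
          ; comm = ⊗-comm }
        ; distribʳ = ⊗-distribʳ
        ; zeroˡ = ⊗-zeroˡ } }

    open CommutativeSemiring commutativeSemiring public
      using (semiring; *-commutativeSemigroup; *-commutativeMonoid)
      renaming (zeroʳ to ⊗-zeroʳ; *-identityʳ to ⊗-identʳ)
    open CommutativeSemigroupProperties *-commutativeSemigroup public
      using (x∙yz≈y∙xz)

    private
      module ∑ = SemiringSum semiring
      module ∏ = CommutativeMonoidSum *-commutativeMonoid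

    ∑≡sum : ∀ m (f : Fin m → Expr V) → ∑ m f ≡ ∑.sum f
    ∑≡sum zero    f = refl
    ∑≡sum (suc m) f = cong (f zero ⊕_) (∑≡sum m (f ∘ suc))

    ∏≡product : ∀ m (f : Fin m → Expr V) → ∏ m f ≡ ∏.sum f
    ∏≡product zero    f = refl
    ∏≡product (suc m) f = cong (f zero ⊗_) (∏≡product m (f ∘ suc))

    ∑-cong : ∀ m {f g : Fin m → Expr V} → (∀ i → f i ≃ g i) → ∑ m f ≃ ∑ m g
    ∑-cong m {f} {g} f≃g = subst₂ _≃_ (sym (∑≡sum m f)) (sym (∑≡sum m g)) (∑.sum-cong-≋ f≃g)

    ∏-cong : ∀ m {f g : Fin m → Expr V} → (∀ i → f i ≃ g i) → ∏ m f ≃ ∏ m g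
    ∏-cong m {f} {g} f≃g = subst₂ _≃_ (sym (∏≡product m f)) (sym (∏≡product m g)) (∏.sum-cong-≋ f≃g)

    ⊗-distribˡ-∑ : ∀ m (p : Expr V) (f : Fin m → Expr V) → p ⊗ ∑ m f ≃ ∑ m (λ i → p ⊗ f i)
    ⊗-distribˡ-∑ m p f =
      subst₂ _≃_ (cong (p ⊗_) (sym (∑≡sum m f))) (sym (∑≡sum m _)) (∑.*-distribˡ-sum p f)

    ∏-distrib-⊗ : ∀ m (f g : Fin m → Expr V) → ∏ m (λ i → f i ⊗ g i) ≃ ∏ m f ⊗ ∏ m g
    ∏-distrib-⊗ m f g =
      subst₂ _≃_ (sym (∏≡product m _)) (sym (cong₂ _⊗_ (∏≡product m f) (∏≡product m g)))
        (∏.∑-distrib-+ f g)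

    ∏-const-1 : ∀ m → ∏ m (λ _ → con 1#) ≃ con {V = V} 1#
    ∏-const-1 m = subst₂ _≃_ (sym (∏≡product m _)) refl (∏.sum-replicate-zero m)

    ∏-δ : ∀ m (i : Fin m) (f : Fin m → Expr V) →
          ∏ m (λ j → if does (i ≟ j) then f j else con 1#) ≃ f i
    ∏-δ (suc m) zero    f = ≃-trans (⊗-cong ≃-refl (∏-const-1 m)) (⊗-identʳ (f zero))
    ∏-δ (suc m) (suc i) f = ≃-trans (⊗-identˡ _) (∏-δ m i (f ∘ suc))

    p⊕[-1]⊗p≃0 : ∀ (p : Expr V) → p ⊕ con (- 1#) ⊗ p ≃ con 0#
    p⊕[-1]⊗p≃0 p = begin
      p ⊕ con (- 1#) ⊗ p           ≈⟨ ⊕-cong (≃-sym (⊗-identˡ p)) ≃-refl ⟩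
      con 1# ⊗ p ⊕ con (- 1#) ⊗ p  ≈⟨ ⊗-distribʳ p _ _ ⟨
      (con 1# ⊕ con (- 1#)) ⊗ p    ≈⟨ ⊗-cong (con-+ 1# (- 1#)) ≃-refl ⟨
      con (1# + - 1#) ⊗ p          ≈⟨ ⊗-cong (con-cong (-‿inverseʳ 1#)) ≃-refl ⟩
      con 0# ⊗ p                   ≈⟨ ⊗-zeroˡ p ⟩
      con 0#                       ∎
      where open import Relation.Binary.Reasoning.Setoid ≃-setoid

  module _ {v w : Level} {V : Set v} {W : Set w} (σ : V → Expr W) where

    subst-cong : ∀ {p q : Expr V} → p ≃ q → subst σ p ≃ subst σ q
    subst-cong ≃-refl            = ≃-refl
    subst-cong (≃-sym e)         = ≃-sym (subst-cong e)
    subst-cong (≃-trans e f)     = ≃-trans (subst-cong e) (subst-cong f)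
    subst-cong (⊕-cong e f)      = ⊕-cong (subst-cong e) (subst-cong f)
    subst-cong (⊗-cong e f)      = ⊗-cong (subst-cong e) (subst-cong f)
    subst-cong (⊕-assoc p q r)   = ⊕-assoc _ _ _
    subst-cong (⊕-comm p q)      = ⊕-comm _ _
    subst-cong (⊕-identˡ p)      = ⊕-identˡ _
    subst-cong (⊗-assoc p q r)   = ⊗-assoc _ _ _
    subst-cong (⊗-comm p q)      = ⊗-comm _ _
    subst-cong (⊗-identˡ p)      = ⊗-identˡ _
    subst-cong (⊗-zeroˡ p)       = ⊗-zeroˡ _
    subst-cong (distribˡ p q r)  = distribˡ _ _ _
    subst-cong (con-cong e)      = con-cong e
    subst-cong (con-+ a b)       = con-+ a b
    subst-cong (con-* a b)       = con-* a b

    subst-∑ : ∀ m (f : Fin m → Expr V) → subst σ (∑ m f) ≡ ∑ m (subst σ ∘ f)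
    subst-∑ zero    f = refl
    subst-∑ (suc m) f = cong (subst σ (f zero) ⊕_) (subst-∑ m (f ∘ suc))

    subst-InIdeal : {G : Expr V → Set (c ⊔ ℓ ⊔ v)} {H : Expr W → Set (c ⊔ ℓ ⊔ w)} →
                    (∀ {p} → G p → InIdeal H (subst σ p)) →
                    ∀ {p} → InIdeal G p → InIdeal H (subst σ p)
    subst-InIdeal σG⊆H (gen g)    = σG⊆H g
    subst-InIdeal σG⊆H zero∈      = zero∈
    subst-InIdeal σG⊆H (add p q)  = add (subst-InIdeal σG⊆H p) (subst-InIdeal σG⊆H q)
    subst-InIdeal σG⊆H (mul r p)  = mul (subst σ r) (subst-InIdeal σG⊆H p)
    subst-InIdeal σG⊆H (resp e p) = resp (subst-cong e) (subst-InIdeal σG⊆H p)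

module GeneratorImages {c ℓ : Level} (F : Field c ℓ) (n : ℕ) where
  open Setting F n
  open Field F using (0#; 1#)
  open PolyProperties (Field.commutativeRing F)
  open import Relation.Binary.Reasoning.Setoid (≃-setoid {V = XY})

  φfactor : Subset n → Fin n → Expr XY
  φfactor S i = ifE (lookup S i) (x i) (y i)

  φfactor-∪∩ : ∀ S T i → φfactor S i ⊗ φfactor T i ≃ φfactor (S ∪ T) i ⊗ φfactor (S ∩ T) i
  φfactor-∪∩ S T i rewrite lookup-zipWith _∨_ i S T | lookup-zipWith _∧_ i S T
    with lookup S i | lookup T i
  ... | true  | true  = ≃-refl
  ... | true  | false = ≃-refl
  ... | false | true  = ⊗-comm _ _
  ... | false | false = ≃-refl

  φvar-∪∩ : ∀ S T → φvar S ⊗ φvar T ≃ φvar (S ∪ T) ⊗ φvar (S ∩ T)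
  φvar-∪∩ S T = begin
    φvar S ⊗ φvar T                                          ≈⟨ ∏-distrib-⊗ n _ _ ⟨
    ∏ n (λ i → φfactor S i ⊗ φfactor T i)                    ≈⟨ ∏-cong n (φfactor-∪∩ S T) ⟩
    ∏ n (λ i → φfactor (S ∪ T) i ⊗ φfactor (S ∩ T) i)        ≈⟨ ∏-distrib-⊗ n _ _ ⟩
    φvar (S ∪ T) ⊗ φvar (S ∩ T)                              ∎

  φ-binom : ∀ S T → φ (binom S T) ≃ con 0#
  φ-binom S T = ≃-trans (⊕-cong (φvar-∪∩ S T) ≃-refl) (p⊕[-1]⊗p≃0 _)

  -- inA, inC, isI stand for j ∈ A, j ∈ C, i = j; the three factors on the right are the
  -- j-th factors of the cofactor of f̃_C, of x_i and of ∏_{j∈C∖i} y_j.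
  split-factor : ∀ inA inC isI → (inA ≡ true → inC ≡ true → ⊥) → (isI ≡ true → inC ≡ true) →
                 ∀ (X Y : Expr XY) →
                 ifE (inA ∨ isI) X Y
                   ≃ ifE inA X (ifE inC (con 1#) Y)
                     ⊗ (ifE isI X (con 1#) ⊗ ifE inC (ifE isI (con 1#) Y) (con 1#))
  split-factor true  true  _     inA⇒¬inC _       X Y = ⊥-elim (inA⇒¬inC refl refl)
  split-factor true  false true  _        isI⇒inC X Y with () ← isI⇒inC refl
  split-factor true  false false _        _       X Y = ≃-sym (≃-trans (⊗-cong ≃-refl (⊗-identˡ _)) (⊗-identʳ X))
  split-factor false true  true  _        _       X Y = ≃-sym (≃-trans (⊗-identˡ _) (⊗-identʳ X))
  split-factor false true  false _        _       X Y = ≃-sym (≃-trans (⊗-identˡ _) (⊗-identˡ Y))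
  split-factor false false true  _        isI⇒inC X Y with () ← isI⇒inC refl
  split-factor false false false _        _       X Y = ≃-sym (≃-trans (⊗-cong ≃-refl (⊗-identˡ _)) (⊗-identʳ Y))

  module CircuitForm (α : Vector) (C A : Subset n) (A∩C≡∅ : ∀ j → j ∈ A → j ∉ C) where

    cofactorFactor : Fin n → Expr XY
    cofactorFactor j = ifE (lookup A j) (x j) (ifE (lookup C j) (con 1#) (y j))

    cofactor : Expr XY
    cofactor = ∏ n cofactorFactor

    xFactor : Fin n → Fin n → Expr XY
    xFactor i j = ifE (does (i ≟ j)) (x j) (con 1#)

    yFactor : Fin n → Fin n → Expr XY
    yFactor i j = ifE (lookup C j) (ifE (does (i ≟ j)) (con 1#) (y j)) (con 1#)

    disjoint : ∀ j → lookup A j ≡ true → lookup C j ≡ true → ⊥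
    disjoint j j∈A j∈C = A∩C≡∅ j (lookup⇒[]= j A j∈A) (lookup⇒[]= j C j∈C)

    φfactor-split : ∀ i j → lookup C i ≡ true →
                    φfactor (A ∪ ⁅ i ⁆) j ≃ cofactorFactor j ⊗ (xFactor i j ⊗ yFactor i j)
    φfactor-split i j i∈C rewrite lookup-zipWith _∨_ j A ⁅ i ⁆ | lookup-⁅⁆ i j with i ≟ j
    ... | yes refl = split-factor _ _ true  (disjoint i) (λ _ → i∈C) (x i) (y i)
    ... | no _     = split-factor _ _ false (disjoint j) (λ ())     (x j) (y j)

    φvar-split : ∀ i → lookup C i ≡ true →
                 φvar (A ∪ ⁅ i ⁆) ≃ cofactor ⊗ (x i ⊗ ∏ n (yFactor i))
    φvar-split i i∈C = begin
      φvar (A ∪ ⁅ i ⁆)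
        ≈⟨ ∏-cong n (λ j → φfactor-split i j i∈C) ⟩
      ∏ n (λ j → cofactorFactor j ⊗ (xFactor i j ⊗ yFactor i j))
        ≈⟨ ∏-distrib-⊗ n _ _ ⟩
      cofactor ⊗ ∏ n (λ j → xFactor i j ⊗ yFactor i j)
        ≈⟨ ⊗-cong ≃-refl (∏-distrib-⊗ n _ _) ⟩
      cofactor ⊗ (∏ n (xFactor i) ⊗ ∏ n (yFactor i))
        ≈⟨ ⊗-cong ≃-refl (⊗-cong (∏-δ n i x) ≃-refl) ⟩
      cofactor ⊗ (x i ⊗ ∏ n (yFactor i))
        ∎

    φ-fCA-term : ∀ i →
      φ (ifE (lookup C i) (con (α i) ⊗ z (A ∪ ⁅ i ⁆)) (con 0#))
        ≃ cofactor ⊗ ifE (lookup C i) (con (α i) ⊗ x i ⊗ ∏ n (yFactor i)) (con 0#)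
    φ-fCA-term i with lookup C i in i∈C
    ... | false = ≃-sym (⊗-zeroʳ cofactor)
    ... | true  = begin
      con (α i) ⊗ φvar (A ∪ ⁅ i ⁆)                     ≈⟨ ⊗-cong ≃-refl (φvar-split i i∈C) ⟩
      con (α i) ⊗ (cofactor ⊗ (x i ⊗ ∏ n (yFactor i))) ≈⟨ x∙yz≈y∙xz _ _ _ ⟩
      cofactor ⊗ (con (α i) ⊗ (x i ⊗ ∏ n (yFactor i))) ≈⟨ ⊗-cong ≃-refl (⊗-assoc _ _ _) ⟨
      cofactor ⊗ (con (α i) ⊗ x i ⊗ ∏ n (yFactor i))   ∎

    φ-fCA : φ (fCA α C A) ≃ cofactor ⊗ ftilde α C
    φ-fCA = begin
      φ (fCA α C A)                        ≡⟨ subst-∑ φvar n _ ⟩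
      ∑ n (φ ∘ fCA-term)                   ≈⟨ ∑-cong n φ-fCA-term ⟩
      ∑ n (λ i → cofactor ⊗ ftilde-term i) ≈⟨ ⊗-distribˡ-∑ n cofactor ftilde-term ⟨
      cofactor ⊗ ftilde α C                ∎
      where
      fCA-term : Fin n → Expr Z
      fCA-term i = ifE (lookup C i) (con (α i) ⊗ z (A ∪ ⁅ i ⁆)) (con 0#)
      ftilde-term : Fin n → Expr XY
      ftilde-term i = ifE (lookup C i) (con (α i) ⊗ x i ⊗ ∏ n (yFactor i)) (con 0#)

  φ-GenSE : (L : Vector → Set ℓ) (α : CircuitForms L) →
            ∀ {p} → GenSE L α p → InIdeal (GenTilde L α) (φ p)
  φ-GenSE L α (inj₁ (S , T , refl)) = resp (≃-sym (φ-binom S T)) zero∈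
  φ-GenSE L α (inj₂ (C , circuit , A , A∩C≡∅ , refl)) =
    resp (≃-sym φ-fCA) (mul cofactor (gen (C , circuit , refl)))
    where open CircuitForm (α C circuit) C A A∩C≡∅

lemma5p16 : {c ℓ : Level} (F : Field c ℓ) (n : ℕ)
    → let open Setting F n in
      (L : Vector → Set ℓ) → IsSubspace L
    → (α : CircuitForms L) → ValidCircuitForms L α
    → ∀ p → InIdeal (GenSE L α) p → InIdeal (GenTilde L α) (φ p)
lemma5p16 F n L _ α _ p =
  PolyProperties.subst-InIdeal (Field.commutativeRing F) φvar (GeneratorImages.φ-GenSE F n L α)
  where open Setting F n using (φvar)
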